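{- Let $q$ be an odd prime power and let $\chi$ be the modified algebraic coloring of the complete graph on $\mathbb{F}_q^2$ defined in the context. If $a,b,c,d\in\mathbb{F}_q^2$ are distinct with $\chi(ab)=\chi(cd)$ and $\chi(bc)=\chi(ad)$, then $(a_1+c_1)(b_1-d_1)=2(b_2-d_2)$ in $\mathbb{F}_q$.
   Context: Vertices are vectors $x=(x_1,x_2)\in\mathbb{F}_q^2$. For distinct $x,y$ let $\chi_1(xy)=(x_1y_1-x_2-y_2,\ \delta(x_1,y_1))$ with $\delta(x_1,y_1)=0$ if $x_1=y_1$ and $1$ otherwise (field operations in $\mathbb{F}_q$). For $\alpha\in\mathbb{F}_q$, the graph $G_\alpha$ on $\mathbb{F}_q\setminus\{\alpha\}$ with edges $\{x,y\}$, $x+y=2\alpha$, is a perfect matching; fix a partition $\mathbb{F}_q\setminus\{\alpha\}=S_\alpha\cup T_\alpha$ with each matching edge having one endpoint in each part, and for $\beta\ne\alpha$ let $f_\alpha(\beta)=S$ if $\beta\in S_\alpha$ and $T$ if $\beta\in T_\alpha$. Fix a linear order $<$ on $\mathbb{F}_q^2$. For $x<y$ with $x_1\ne y_1$ let $\chi_2(xy)=(f_{x_1}(y_1),f_{y_1}(x_1))$; when $x_1=y_1$, $\chi_2(xy)$ is some fixed value. Then $\chi(xy)=(\chi_1(xy),\chi_2(xy))$. -}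

module Defs where

open import Level using (0ℓ)
open import Data.Nat using (ℕ; suc; _^_; _%_)
open import Data.Nat.Primality using (Prime)
open import Data.Fin using (Fin)
import Data.Fin as Fin
open import Data.Bool using (Bool; true; false)
open import Data.Product using (_×_; _,_; proj₁; proj₂; ∃; ∃-syntax)
open import Relation.Nullary using (¬_; Dec; yes; no)
open import Relation.Binary using (Rel; Tri; tri<; tri≈; tri>; IsStrictTotalOrder; DecidableEquality)
open import Relation.Binary.PropositionalEquality using (_≡_; _≢_; refl; sym; trans; cong)
open import Algebra.Structures using (IsCommutativeRing)
open import Function.Bundles using (_↔_; Inverse)

record FiniteField (q : ℕ) : Set₁ where
  infixl 7 _*_
  infixl 6 _+_
  field
    Carrier : Set
    _+_ _*_ : Carrier → Carrier → Carrier
    -_ : Carrier → Carrier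
    0# 1# : Carrier
    isCommutativeRing : IsCommutativeRing _≡_ _+_ _*_ -_ 0# 1#
    0≢1 : 0# ≢ 1#
    inverse : ∀ x → x ≢ 0# → ∃[ y ] (x * y ≡ 1#)
    card : Carrier ↔ Fin q

  infixl 6 _-_
  _-_ : Carrier → Carrier → Carrier
  x - y = x + (- y)

  2# : Carrier
  2# = 1# + 1#

  _≟_ : DecidableEquality Carrier
  x ≟ y with Fin._≟_ (Inverse.to card x) (Inverse.to card y)
  ... | yes p = yes (trans (sym (Inverse.strictlyInverseʳ card x))
                      (trans (cong (Inverse.from card) p) (Inverse.strictlyInverseʳ card y)))
  ... | no ¬p = no (λ e → ¬p (cong (Inverse.to card) e))

IsPrimePower : ℕ → Set
IsPrimePower q = ∃[ p ] ∃[ k ] (Prime p × q ≡ p ^ suc k)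

Odd : ℕ → Set
Odd q = q % 2 ≡ 1

data Side : Set where
  S T : Side

module Coloring {q : ℕ} (F : FiniteField q) where
  open FiniteField F public

  Vertex : Set
  Vertex = Carrier × Carrier

  δ : Carrier → Carrier → Bool
  δ x y with x ≟ y
  ... | yes _ = false
  ... | no _ = true

  χ₁ : Vertex → Vertex → Carrier × Bool
  χ₁ (x₁ , x₂) (y₁ , y₂) = (x₁ * y₁ - x₂ - y₂ , δ x₁ y₁)

  -- f α β = f_α(β); the values f α α are irrelevant.
  -- Valid partitions: each matching edge {β, 2α-β} of G_α has one endpoint in each part.
  IsMatchingPartition : (Carrier → Carrier → Side) → Set
  IsMatchingPartition f = ∀ α β → β ≢ α → f α β ≢ f α (2# * α - β)

  χ₂ : (f : Carrier → Carrier → Side) {_<_ : Rel Vertex 0ℓ} →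
       IsStrictTotalOrder _≡_ _<_ → Side × Side → Vertex → Vertex → Side × Side
  χ₂ f ord c₀ x y with proj₁ x ≟ proj₁ y
  ... | yes _ = c₀
  ... | no _ with IsStrictTotalOrder.compare ord x y
  ...   | tri< _ _ _ = (f (proj₁ x) (proj₁ y) , f (proj₁ y) (proj₁ x))
  ...   | tri≈ _ _ _ = c₀   -- x ≡ y: not an edge, irrelevant
  ...   | tri> _ _ _ = (f (proj₁ y) (proj₁ x) , f (proj₁ x) (proj₁ y))

  χ : (f : Carrier → Carrier → Side) {_<_ : Rel Vertex 0ℓ} →
      IsStrictTotalOrder _≡_ _<_ → Side × Side → Vertex → Vertex →
      (Carrier × Bool) × (Side × Side)
  χ f ord c₀ x y = (χ₁ x y , χ₂ f ord c₀ x y)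

module Submission where

-- Proof idea.  Only the first coordinate of the algebraic colouring χ₁ is
-- needed: write  σ(x,y) = x₁y₁ − x₂ − y₂  for it.  The argument works in any
-- commutative ring.
--
--   * σ(a,b) = σ(c,d) is equivalent to the subtraction-free balance
--       a₁b₁ + (c₂ + d₂) = c₁d₁ + (a₂ + b₂),
--     and likewise σ(b,c) = σ(a,d) to  b₁c₁ + (a₂ + d₂) = a₁d₁ + (b₂ + c₂).
--   * Adding the two balances, both sides contain a₂ + c₂; cancelling it
--     leaves  (a₁ + c₁)b₁ + 2d₂ = (a₁ + c₁)d₁ + 2b₂.
--   * Moving terms back across gives  (a₁ + c₁)(b₁ − d₁) = 2(b₂ − d₂).

open import Defs
open import Level using (0ℓ)
open import Data.Nat using (ℕ)
open import Data.Maybe using (nothing)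
open import Data.Product using (_×_; _,_; proj₁; proj₂)
open import Function using (_∘_)
open import Relation.Binary using (Rel; IsStrictTotalOrder)
open import Relation.Binary.PropositionalEquality using (_≡_; _≢_; cong)
open import Algebra.Bundles using (CommutativeRing)
import Algebra.Properties.AbelianGroup as AbelianGroupProperties
import Algebra.Properties.Ring as RingProperties
import Algebra.Solver.Ring.NaturalCoefficients as SemiringSolver
import Relation.Binary.Reasoning.Setoid as SetoidReasoning

module CommutativeRingFacts {r₁ r₂} (R : CommutativeRing r₁ r₂) where
  open CommutativeRing R
  open AbelianGroupProperties +-abelianGroup
    using (⁻¹-∙-comm; //-rightDividesˡ; //-rightDividesʳ; x≈z//y; ∙-cancelʳ)
  open RingProperties ring using (x[y-z]≈xy-xz)
  open SemiringSolver commutativeSemiring (λ _ _ → nothing) using (solve; _:=_; _:+_; _:*_; con)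
  open SetoidReasoning setoid

  sub-sub≈sub-sum : ∀ x y z → x - y - z ≈ x - (y + z)
  sub-sub≈sub-sum x y z = begin
    x - y - z       ≈⟨ +-assoc x (- y) (- z) ⟩
    x + (- y - z)   ≈⟨ +-congˡ (⁻¹-∙-comm y z) ⟩
    x - (y + z)     ∎

  sub≈sub⇒sum≈sum : ∀ {x y u v} → x - y ≈ u - v → x + v ≈ u + y
  sub≈sub⇒sum≈sum {x} {y} {u} {v} x-y≈u-v = begin
    x + v             ≈⟨ +-congʳ (//-rightDividesˡ y x) ⟨
    (x - y) + y + v   ≈⟨ +-congʳ (+-congʳ x-y≈u-v) ⟩
    (u - v) + y + v   ≈⟨ +-assoc (u - v) y v ⟩
    (u - v) + (y + v) ≈⟨ +-congˡ (+-comm y v) ⟩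
    (u - v) + (v + y) ≈⟨ +-assoc (u - v) v y ⟨
    (u - v) + v + y   ≈⟨ +-congʳ (//-rightDividesˡ v u) ⟩
    u + y             ∎

  sum≈sum⇒sub≈sub : ∀ {x y u v} → x + v ≈ u + y → x - u ≈ y - v
  sum≈sum⇒sub≈sub {x} {y} {u} {v} x+v≈u+y = begin
    x - u             ≈⟨ +-congʳ (x≈z//y x v (u + y) x+v≈u+y) ⟩
    (u + y) - v - u   ≈⟨ +-congʳ (+-assoc u y (- v)) ⟩
    (u + (y - v)) - u ≈⟨ +-congʳ (+-comm u (y - v)) ⟩
    (y - v) + u - u   ≈⟨ //-rightDividesʳ u (y - v) ⟩
    y - v             ∎

  -- σ(x,y) = x₁y₁ − x₂ − y₂, the first coordinate of the colour χ₁(xy).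
  σ : Carrier × Carrier → Carrier × Carrier → Carrier
  σ (x₁ , x₂) (y₁ , y₂) = x₁ * y₁ - x₂ - y₂

  σ-balance : ∀ x y z w → σ x y ≈ σ z w →
    proj₁ x * proj₁ y + (proj₂ z + proj₂ w) ≈ proj₁ z * proj₁ w + (proj₂ x + proj₂ y)
  σ-balance (x₁ , x₂) (y₁ , y₂) (z₁ , z₂) (w₁ , w₂) σxy≈σzw =
    sub≈sub⇒sum≈sum (begin
      x₁ * y₁ - (x₂ + y₂) ≈⟨ sub-sub≈sub-sum (x₁ * y₁) x₂ y₂ ⟨
      x₁ * y₁ - x₂ - y₂   ≈⟨ σxy≈σzw ⟩
      z₁ * w₁ - z₂ - w₂   ≈⟨ sub-sub≈sub-sum (z₁ * w₁) z₂ w₂ ⟩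
      z₁ * w₁ - (z₂ + w₂) ∎)

  quadrilateral-relation : ∀ a b c d → σ a b ≈ σ c d → σ b c ≈ σ a d →
    (proj₁ a + proj₁ c) * (proj₁ b - proj₁ d) ≈ (1# + 1#) * (proj₂ b - proj₂ d)
  quadrilateral-relation a@(a₁ , a₂) b@(b₁ , b₂) c@(c₁ , c₂) d@(d₁ , d₂) ab≈cd bc≈ad = begin
    (a₁ + c₁) * (b₁ - d₁)                   ≈⟨ x[y-z]≈xy-xz (a₁ + c₁) b₁ d₁ ⟩
    (a₁ + c₁) * b₁ - (a₁ + c₁) * d₁         ≈⟨ sum≈sum⇒sub≈sub balanced ⟩
    (1# + 1#) * b₂ - (1# + 1#) * d₂         ≈⟨ x[y-z]≈xy-xz (1# + 1#) b₂ d₂ ⟨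
    (1# + 1#) * (b₂ - d₂)                   ∎
    where
    -- Sum of the two balances, regrouped so that a₂ + c₂ appears on both sides.
    summed : (a₁ + c₁) * b₁ + (1# + 1#) * d₂ + (a₂ + c₂) ≈
             (a₁ + c₁) * d₁ + (1# + 1#) * b₂ + (a₂ + c₂)
    summed = begin
      (a₁ + c₁) * b₁ + (1# + 1#) * d₂ + (a₂ + c₂)
        ≈⟨ regroupˡ a₁ a₂ b₁ c₁ c₂ d₂ ⟩
      a₁ * b₁ + (c₂ + d₂) + (b₁ * c₁ + (a₂ + d₂))
        ≈⟨ +-cong (σ-balance a b c d ab≈cd) (σ-balance b c a d bc≈ad) ⟩
      c₁ * d₁ + (a₂ + b₂) + (a₁ * d₁ + (b₂ + c₂))
        ≈⟨ regroupʳ a₁ a₂ b₂ c₁ c₂ d₁ ⟨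
      (a₁ + c₁) * d₁ + (1# + 1#) * b₂ + (a₂ + c₂) ∎
      where
      regroupˡ : ∀ a₁ a₂ b₁ c₁ c₂ d₂ →
        (a₁ + c₁) * b₁ + (1# + 1#) * d₂ + (a₂ + c₂) ≈
        a₁ * b₁ + (c₂ + d₂) + (b₁ * c₁ + (a₂ + d₂))
      regroupˡ = solve 6 (λ a₁ a₂ b₁ c₁ c₂ d₂ →
        (a₁ :+ c₁) :* b₁ :+ (con 1 :+ con 1) :* d₂ :+ (a₂ :+ c₂) :=
        a₁ :* b₁ :+ (c₂ :+ d₂) :+ (b₁ :* c₁ :+ (a₂ :+ d₂))) refl
      regroupʳ : ∀ a₁ a₂ b₂ c₁ c₂ d₁ →
        (a₁ + c₁) * d₁ + (1# + 1#) * b₂ + (a₂ + c₂) ≈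
        c₁ * d₁ + (a₂ + b₂) + (a₁ * d₁ + (b₂ + c₂))
      regroupʳ = solve 6 (λ a₁ a₂ b₂ c₁ c₂ d₁ →
        (a₁ :+ c₁) :* d₁ :+ (con 1 :+ con 1) :* b₂ :+ (a₂ :+ c₂) :=
        c₁ :* d₁ :+ (a₂ :+ b₂) :+ (a₁ :* d₁ :+ (b₂ :+ c₂))) refl

    balanced : (a₁ + c₁) * b₁ + (1# + 1#) * d₂ ≈ (a₁ + c₁) * d₁ + (1# + 1#) * b₂
    balanced = ∙-cancelʳ (a₂ + c₂) _ _ summed

commutativeRing : ∀ {q} → FiniteField q → CommutativeRing 0ℓ 0ℓ
commutativeRing F = record { isCommutativeRing = FiniteField.isCommutativeRing F }

lemma15 : (q : ℕ) → IsPrimePower q → Odd q → (F : FiniteField q) →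
    let open Coloring F in
    (f : Carrier → Carrier → Side) → IsMatchingPartition f →
    {_<_ : Rel Vertex 0ℓ} → (ord : IsStrictTotalOrder _≡_ _<_) → (c₀ : Side × Side) →
    (a b c d : Vertex) →
    a ≢ b → a ≢ c → a ≢ d → b ≢ c → b ≢ d → c ≢ d →
    χ f ord c₀ a b ≡ χ f ord c₀ c d →
    χ f ord c₀ b c ≡ χ f ord c₀ a d →
    (proj₁ a + proj₁ c) * (proj₁ b - proj₁ d) ≡ 2# * (proj₂ b - proj₂ d)
lemma15 _ _ _ F f _ ord c₀ a b c d _ _ _ _ _ _ χab≡χcd χbc≡χad =
  quadrilateral-relation a b c d (cong (proj₁ ∘ proj₁) χab≡χcd) (cong (proj₁ ∘ proj₁) χbc≡χad)
  where open CommutativeRingFacts (commutativeRing F) using (quadrilateral-relation)
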